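{- Let $k,r,n\in\mathbb{N}$ and let $a_1,\ldots,a_k\in\mathbb{Z}$ with $(a_i,n)=1$ for all $i$. Then $$\sum_{\substack{1\le m_1,\ldots,m_k\le n\\ (m_i,n)=1\ (i=1,\ldots,k)\\ 1\le b_1,\ldots,b_r\le n}}(m_1-a_1,\ldots,m_k-a_k,b_1,\ldots,b_r,n) = \phi(n)^k\sum_{d\mid n}\frac{d^r}{\phi\!\left(\frac nd\right)^{k-1}}.$$
   Context: $\mathbb{N}$ denotes the positive integers, $(x_1,\ldots,x_m)$ the usual greatest common divisor, and $\phi$ Euler's totient function. The sum on the left is over integers $m_1,\ldots,m_k,b_1,\ldots,b_r$ in the indicated ranges. -}

module Defs where

open import Data.Nat using (ℕ; zero; suc; _+_; _*_; _^_; _∸_)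
open import Data.Nat.GCD using (gcd)
open import Data.Nat.Divisibility using (_∣?_)
open import Data.Nat.DivMod using (_/_)
open import Data.Integer as ℤ using (ℤ; +_; ∣_∣)
open import Data.List using (List; []; _∷_; _++_; map; concatMap; filter; foldr; upTo; length)
open import Data.Nat.ListAction using (sum)
open import Data.Vec as Vec using (Vec; []; _∷_; zipWith; toList)
open import Data.Rational as ℚ using (ℚ)
open import Relation.Binary.PropositionalEquality using (_≡_)
open import Data.Nat using (_≟_)

range1 : ℕ → List ℕ
range1 n = map suc (upTo n)

φ : ℕ → ℕ
φ n = length (filter (λ m → gcd m n ≟ 1) (range1 n))

units : ℕ → List ℕ
units n = filter (λ m → gcd m n ≟ 1) (range1 n)

tuples : (k : ℕ) → List ℕ → List (Vec ℕ k)
tuples zero    xs = [] ∷ []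
tuples (suc k) xs = concatMap (λ x → map (x ∷_) (tuples k xs)) xs

gcdList : List ℕ → ℕ
gcdList = foldr gcd 0

divisors : ℕ → List ℕ
divisors n = filter (_∣? n) (range1 n)

-- The left-hand side: sum over 1 ≤ m_i ≤ n with (m_i,n)=1 and 1 ≤ b_j ≤ n of
-- (m_1 - a_1, …, m_k - a_k, b_1, …, b_r, n); the gcd of integers is the gcd of
-- their absolute values.
lhs : (k r n : ℕ) → Vec ℤ k → ℕ
lhs k r n a =
  sum (concatMap (λ ms → map (λ bs →
         gcdList (toList (zipWith (λ m aᵢ → ∣ + m ℤ.- aᵢ ∣) ms a) ++ toList bs ++ (n ∷ [])))
       (tuples r (range1 n)))
     (tuples k (units n)))

-- n / d for divisors d ≥ 1 (d = 0 never occurs: divisors are ≥ 1)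
_div_ : ℕ → ℕ → ℕ
n div zero    = 0
n div (suc d) = n / suc d

-- x / y as a rational number; the case y = 0 never occurs in the statement
-- (it is only used with y = φ(n/d)^(k-1) ≥ 1 for d ∣ n, n ≥ 1).
_⁄_ : ℕ → ℕ → ℚ
x ⁄ zero  = ℚ.0ℚ
x ⁄ suc y = (+ x) ℚ./ suc y

rhs : (k r n : ℕ) → ℚ
rhs k r n = (+ (φ n ^ k)) ℚ./ 1 ℚ.*
  foldr ℚ._+_ ℚ.0ℚ (map (λ d → (d ^ r) ⁄ (φ (n div d) ^ (k ∸ 1))) (divisors n))

-- Write each gcd as ∑_{d ∣ gcd} φ(d).  For a fixed d ∣ n the conditions d ∣ mᵢ - aᵢ and d ∣ bⱼ
-- then decouple, and the left-hand side becomes ∑_{d ∣ n} φ(d) N(d)^k (n/d)^r, where N(d) is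
-- the number of units m mod n with m ≡ aᵢ (mod d).  N(d) does not depend on the class of aᵢ:
-- multiplication by a unit of ℤ/n that lifts aᵢ mod d permutes the units and carries the class
-- of 1 onto that of aᵢ.  Sorting all units by their residue mod d therefore gives
-- φ(n) = φ(d) N(d), and after the substitution d ↦ n/d the terms are those of the right-hand side.
module Submission where

open import Defs
open import Data.Nat as ℕ hiding (_/_)
open import Data.Nat.Properties
open import Algebra.Properties.CommutativeSemigroup +-commutativeSemigroup
  using () renaming (interchange to +-interchange)
open import Algebra.Properties.CommutativeMonoid.Sum +-0-commutativeMonoid
  using (∑-permute) renaming (sum to ∑ᶠ)
open import Algebra.Properties.Monoid.Sum +-0-monoid using (sum-cong-≗)
open import Data.Nat.Divisibility
open import Data.Nat.DivMod
  using (m*n/n≡m; m*[n/m]≡n; m/n<m; m%n<n; m%n%n≡m%n; m<n⇒m%n≡m; [m+n]%n≡m%n; [m+kn]%n≡m%n;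
         %-distribˡ-*; m∣n⇒o%n%m≡o%m; m*n%n≡0)
open import Data.Nat.GCD
open import Data.Nat.Coprimality using (Coprime; coprime-Bézout; coprime-divisor; gcd≡1⇒coprime; coprime⇒gcd≡1)
open import Data.Nat.Induction using (<-wellFounded)
open import Data.Nat.ListAction using (sum; product)
open import Data.Nat.ListAction.Properties using (sum-++; product-++)
open import Data.Nat.Tactic.RingSolver using (solve-∀)
open import Data.Integer as ℤ using (ℤ; +_; ∣_∣)
import Data.Integer.Properties as ℤ
open import Data.Integer.DivMod using (_%ℕ_; _/ℕ_; a≡a%ℕn+[a/ℕn]*n; n%ℕd<d)
open import Data.Integer.Divisibility.Signed as ℤ∣ using () renaming (_∣_ to _∣ℤ_)
open import Data.Integer.Tactic.RingSolver using () renaming (solve-∀ to ℤ-solve-∀)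
open import Data.Rational as ℚ using (ℚ; _/_; 0ℚ; toℚᵘ)
import Data.Rational.Properties as ℚ
open import Data.Rational.Unnormalised as ℚᵘ using (mkℚᵘ; *≡*)
import Data.Rational.Unnormalised.Properties as ℚᵘ
open import Data.List using (List; []; _∷_; _++_; map; concatMap; filter; foldr; upTo; applyUpTo; length)
open import Data.List.Properties using (map-++; map-id; ++-assoc; upTo-∷ʳ; map-upTo; filter-accept; map-cong-local)
open import Data.List.Relation.Unary.All as All using (All)
open import Data.List.Relation.Unary.All.Properties using (all-filter; filter⁺; map⁺)
open import Data.Vec using (Vec; []; _∷_; zipWith; toList; lookup)
open import Data.Fin as Fin using (Fin; toℕ; fromℕ<)
open import Data.Fin.Properties using (toℕ-injective; toℕ<n; toℕ-fromℕ<)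
open import Data.Fin.Permutation using (Permutation; permutation)
open import Data.Product using (Σ; ∃; _×_; _,_; proj₁; proj₂)
open import Data.Sum using (inj₁; inj₂)
open import Function using (_∘_)
open import Induction.WellFounded using (Acc; acc)
open import Relation.Nullary using (Dec; yes; no; ¬_)
open import Relation.Nullary.Negation using (contradiction)
open import Relation.Binary.PropositionalEquality
open ≡-Reasoning

-- Indicators and finite sums

𝟙 : ∀ {p} {P : Set p} → Dec P → ℕ
𝟙 (yes _) = 1
𝟙 (no _)  = 0

module _ {p q} {P : Set p} {Q : Set q} where

  𝟙-cong : (P? : Dec P) (Q? : Dec Q) → (P → Q) → (Q → P) → 𝟙 P? ≡ 𝟙 Q?
  𝟙-cong (yes _) (yes _) _ _ = refl
  𝟙-cong (yes p) (no ¬q) f _ = contradiction (f p) ¬q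
  𝟙-cong (no ¬p) (yes q) _ g = contradiction (g q) ¬p
  𝟙-cong (no _)  (no _)  _ _ = refl

module _ {p} {P : Set p} where

  𝟙-yes : (P? : Dec P) → P → 𝟙 P? ≡ 1
  𝟙-yes (yes _) _ = refl
  𝟙-yes (no ¬p) p = contradiction p ¬p

  𝟙-no : (P? : Dec P) → ¬ P → 𝟙 P? ≡ 0
  𝟙-no (yes p) ¬p = contradiction p ¬p
  𝟙-no (no _)  _  = refl

𝟙-≟-suc : ∀ m n → 𝟙 (suc m ≟ suc n) ≡ 𝟙 (m ≟ n)
𝟙-≟-suc m n = 𝟙-cong (suc m ≟ suc n) (m ≟ n) suc-injective (cong suc)

𝟙-≟-sym : ∀ m n → 𝟙 (m ≟ n) ≡ 𝟙 (n ≟ m)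
𝟙-≟-sym m n = 𝟙-cong (m ≟ n) (n ≟ m) sym sym

∑ : {A : Set} → List A → (A → ℕ) → ℕ
∑ xs f = sum (map f xs)
infix 5 ∑
syntax ∑ xs (λ x → e) = ∑[ x ∈ xs ] e

module _ {A : Set} where

  ∑-cong : (xs : List A) {f g : A → ℕ} → (∀ x → f x ≡ g x) → ∑ xs f ≡ ∑ xs g
  ∑-cong []       _ = refl
  ∑-cong (x ∷ xs) e = cong₂ _+_ (e x) (∑-cong xs e)

  ∑-zero : (xs : List A) → (∑[ _ ∈ xs ] 0) ≡ 0
  ∑-zero []       = refl
  ∑-zero (_ ∷ xs) = ∑-zero xs

  ∑-+ : (xs : List A) (f g : A → ℕ) → (∑[ x ∈ xs ] (f x + g x)) ≡ ∑ xs f + ∑ xs g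
  ∑-+ []       f g = refl
  ∑-+ (x ∷ xs) f g = trans (cong (_+_ (f x + g x)) (∑-+ xs f g)) (+-interchange (f x) (g x) _ _)

  ∑-*ˡ : (xs : List A) (c : ℕ) (f : A → ℕ) → (∑[ x ∈ xs ] c * f x) ≡ c * ∑ xs f
  ∑-*ˡ []       c f = sym (*-zeroʳ c)
  ∑-*ˡ (x ∷ xs) c f = trans (cong (_+_ (c * f x)) (∑-*ˡ xs c f)) (sym (*-distribˡ-+ c (f x) _))

  ∑-*ʳ : (xs : List A) (c : ℕ) (f : A → ℕ) → (∑[ x ∈ xs ] f x * c) ≡ ∑ xs f * c
  ∑-*ʳ xs c f = trans (∑-cong xs (λ x → *-comm (f x) c)) (trans (∑-*ˡ xs c f) (*-comm c _))

  ∑-map : {B : Set} (g : B → A) (xs : List B) (f : A → ℕ) → ∑ (map g xs) f ≡ (∑[ x ∈ xs ] f (g x))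
  ∑-map g []       f = refl
  ∑-map g (x ∷ xs) f = cong (_+_ (f (g x))) (∑-map g xs f)

  ∑-++ : (xs ys : List A) (f : A → ℕ) → ∑ (xs ++ ys) f ≡ ∑ xs f + ∑ ys f
  ∑-++ xs ys f = trans (cong sum (map-++ f xs ys)) (sum-++ (map f xs) (map f ys))

  ∑-concatMap : {B : Set} (g : B → List A) (xs : List B) (f : A → ℕ) →
    ∑ (concatMap g xs) f ≡ (∑[ x ∈ xs ] ∑ (g x) f)
  ∑-concatMap g []       f = refl
  ∑-concatMap g (x ∷ xs) f = trans (∑-++ (g x) (concatMap g xs) f) (cong (_+_ (∑ (g x) f)) (∑-concatMap g xs f))

  ∑-filter : ∀ {p} {P : A → Set p} (P? : ∀ x → Dec (P x)) (xs : List A) (f : A → ℕ) →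
    ∑ (filter P? xs) f ≡ (∑[ x ∈ xs ] 𝟙 (P? x) * f x)
  ∑-filter P? []       f = refl
  ∑-filter P? (x ∷ xs) f with P? x
  ... | yes _ = cong₂ _+_ (sym (+-identityʳ (f x))) (∑-filter P? xs f)
  ... | no _  = ∑-filter P? xs f

  length≡∑1 : (xs : List A) → length xs ≡ (∑[ _ ∈ xs ] 1)
  length≡∑1 []       = refl
  length≡∑1 (_ ∷ xs) = cong suc (length≡∑1 xs)

∑-comm : {A B : Set} (xs : List A) (ys : List B) (f : A → B → ℕ) →
  (∑[ x ∈ xs ] ∑[ y ∈ ys ] f x y) ≡ (∑[ y ∈ ys ] ∑[ x ∈ xs ] f x y)
∑-comm []       ys f = sym (∑-zero ys)
∑-comm (x ∷ xs) ys f = begin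
  ∑ ys (f x) + (∑[ x ∈ xs ] ∑[ y ∈ ys ] f x y) ≡⟨ cong (_+_ (∑ ys (f x))) (∑-comm xs ys f) ⟩
  ∑ ys (f x) + (∑[ y ∈ ys ] ∑[ x ∈ xs ] f x y) ≡⟨ ∑-+ ys (f x) _ ⟨
  (∑[ y ∈ ys ] (f x y + (∑[ x ∈ xs ] f x y)))  ∎

∑< : ℕ → (ℕ → ℕ) → ℕ
∑< n f = ∑ (upTo n) f
infix 5 ∑<
syntax ∑< n (λ x → e) = ∑[ x < n ] e

∑<-suc : ∀ n f → ∑< (suc n) f ≡ f 0 + (∑[ x < n ] f (suc x))
∑<-suc n f = cong (_+_ (f 0)) (begin
  sum (map f (applyUpTo suc n)) ≡⟨ cong (λ xs → sum (map f xs)) (map-upTo suc n) ⟨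
  ∑ (map suc (upTo n)) f        ≡⟨ ∑-map suc (upTo n) f ⟩
  (∑[ x < n ] f (suc x))        ∎)

∑<-snoc : ∀ n f → ∑< (suc n) f ≡ ∑< n f + f n
∑<-snoc n f = begin
  ∑< (suc n) f             ≡⟨ cong (λ xs → ∑ xs f) (upTo-∷ʳ n) ⟨
  ∑ (upTo n ++ n ∷ []) f   ≡⟨ ∑-++ (upTo n) (n ∷ []) f ⟩
  ∑< n f + (f n + 0)       ≡⟨ cong (_+_ (∑< n f)) (+-identityʳ (f n)) ⟩
  ∑< n f + f n             ∎

∑<-cong : ∀ n {f g : ℕ → ℕ} → (∀ x → x < n → f x ≡ g x) → ∑< n f ≡ ∑< n g
∑<-cong zero    e = refl
∑<-cong (suc n) {f} {g} e = begin
  ∑< (suc n) f                      ≡⟨ ∑<-suc n f ⟩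
  f 0 + (∑[ x < n ] f (suc x))      ≡⟨ cong₂ _+_ (e 0 z<s) (∑<-cong n (λ x x<n → e (suc x) (s<s x<n))) ⟩
  g 0 + (∑[ x < n ] g (suc x))      ≡⟨ ∑<-suc n g ⟨
  ∑< (suc n) g                      ∎

∑<-+ : ∀ a b f → ∑< (a + b) f ≡ ∑< a f + (∑[ x < b ] f (a + x))
∑<-+ zero    b f = refl
∑<-+ (suc a) b f = begin
  ∑< (suc a + b) f
    ≡⟨ ∑<-suc (a + b) f ⟩
  f 0 + (∑[ x < a + b ] f (suc x))
    ≡⟨ cong (_+_ (f 0)) (∑<-+ a b (λ x → f (suc x))) ⟩
  f 0 + ((∑[ x < a ] f (suc x)) + (∑[ x < b ] f (suc a + x)))
    ≡⟨ +-assoc (f 0) _ _ ⟨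
  f 0 + (∑[ x < a ] f (suc x)) + (∑[ x < b ] f (suc a + x))
    ≡⟨ cong (_+ (∑[ x < b ] f (suc a + x))) (∑<-suc a f) ⟨
  ∑< (suc a) f + (∑[ x < b ] f (suc a + x))
    ∎

∑<-const : ∀ n c → (∑[ _ < n ] c) ≡ n * c
∑<-const zero    c = refl
∑<-const (suc n) c = trans (∑<-suc n (λ _ → c)) (cong (_+_ c) (∑<-const n c))

∑<-zero : ∀ n {f} → (∀ x → x < n → f x ≡ 0) → ∑< n f ≡ 0
∑<-zero n e = trans (∑<-cong n e) (trans (∑<-const n 0) (*-zeroʳ n))

∑<-select : ∀ n (h : ℕ → ℕ) {t} → t < n → (∑[ c < n ] 𝟙 (c ≟ t) * h c) ≡ h t
∑<-select (suc n) h {zero} _ = begin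
  (∑[ c < suc n ] 𝟙 (c ≟ 0) * h c)                   ≡⟨ ∑<-suc n (λ c → 𝟙 (c ≟ 0) * h c) ⟩
  h 0 + 0 + (∑[ c < n ] 𝟙 (suc c ≟ 0) * h (suc c))   ≡⟨ cong₂ _+_ (+-identityʳ (h 0)) (∑<-zero n (λ _ _ → refl)) ⟩
  h 0 + 0                                            ≡⟨ +-identityʳ (h 0) ⟩
  h 0                                                ∎
∑<-select (suc n) h {suc t} (s<s t<n) = begin
  (∑[ c < suc n ] 𝟙 (c ≟ suc t) * h c)               ≡⟨ ∑<-suc n (λ c → 𝟙 (c ≟ suc t) * h c) ⟩
  (∑[ c < n ] 𝟙 (suc c ≟ suc t) * h (suc c))         ≡⟨ ∑<-cong n (λ c _ → cong (_* h (suc c)) (𝟙-≟-suc c t)) ⟩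
  (∑[ c < n ] 𝟙 (c ≟ t) * h (suc c))                 ≡⟨ ∑<-select n (λ c → h (suc c)) t<n ⟩
  h (suc t)                                          ∎

∑-range1 : ∀ n f → f n ≡ f 0 → ∑ (range1 n) f ≡ ∑< n f
∑-range1 n f fn≡f0 = begin
  ∑ (map suc (upTo n)) f    ≡⟨ ∑-map suc (upTo n) f ⟩
  (∑[ x < n ] f (suc x))    ≡⟨ +-cancelʳ-≡ _ _ _ (trans (shift n) (cong (_+_ (∑< n f)) fn≡f0)) ⟩
  ∑< n f                    ∎
  where
  shift : ∀ m → (∑[ x < m ] f (suc x)) + f 0 ≡ ∑< m f + f m
  shift zero    = refl
  shift (suc m) = begin
    (∑[ x < suc m ] f (suc x)) + f 0       ≡⟨ cong (_+ f 0) (∑<-snoc m (λ x → f (suc x))) ⟩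
    (∑[ x < m ] f (suc x)) + f (suc m) + f 0 ≡⟨ +-assoc _ (f (suc m)) (f 0) ⟩
    (∑[ x < m ] f (suc x)) + (f (suc m) + f 0) ≡⟨ cong (_+_ (∑[ x < m ] f (suc x))) (+-comm (f (suc m)) (f 0)) ⟩
    (∑[ x < m ] f (suc x)) + (f 0 + f (suc m)) ≡⟨ +-assoc _ (f 0) (f (suc m)) ⟨
    (∑[ x < m ] f (suc x)) + f 0 + f (suc m) ≡⟨ cong (_+ f (suc m)) (shift m) ⟩
    ∑< m f + f m + f (suc m)               ≡⟨ cong (_+ f (suc m)) (∑<-snoc m f) ⟨
    ∑< (suc m) f + f (suc m)               ∎

∑<-multiples : ∀ q e .{{_ : NonZero e}} (h : ℕ → ℕ) →
  (∑[ x < q * e ] 𝟙 (e ∣? x) * h x) ≡ (∑[ y < q ] h (y * e))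
∑<-multiples zero    e h = refl
∑<-multiples (suc q) e@(suc e-1) h = begin
  ∑< (e + q * e) f                         ≡⟨ ∑<-+ e (q * e) f ⟩
  ∑< e f + (∑[ x < q * e ] f (e + x))      ≡⟨ cong₂ _+_ first-block (∑<-cong (q * e) (λ x _ → shift-block x)) ⟩
  h 0 + (∑[ x < q * e ] 𝟙 (e ∣? x) * h (e + x)) ≡⟨ cong (_+_ (h 0)) (∑<-multiples q e (λ x → h (e + x))) ⟩
  h 0 + (∑[ y < q ] h (e + y * e))         ≡⟨ ∑<-suc q (λ y → h (y * e)) ⟨
  (∑[ y < suc q ] h (y * e))               ∎
  where
  f : ℕ → ℕ
  f x = 𝟙 (e ∣? x) * h x
  first-block : ∑< e f ≡ h 0
  first-block = begin
    ∑< e f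
      ≡⟨ ∑<-suc e-1 f ⟩
    𝟙 (e ∣? 0) * h 0 + (∑[ x < e-1 ] f (suc x))
      ≡⟨ cong₂ _+_ (cong (_* h 0) (𝟙-yes (e ∣? 0) (e ∣0)))
                   (∑<-zero e-1 λ x x<e-1 → cong (_* h (suc x)) (𝟙-no (e ∣? suc x) (>⇒∤ (s<s x<e-1)))) ⟩
    1 * h 0 + 0
      ≡⟨ trans (+-identityʳ _) (*-identityˡ _) ⟩
    h 0
      ∎
  shift-block : ∀ x → f (e + x) ≡ 𝟙 (e ∣? x) * h (e + x)
  shift-block x = cong (_* h (e + x))
    (𝟙-cong (e ∣? e + x) (e ∣? x) (λ e∣e+x → ∣m+n∣m⇒∣n e∣e+x ∣-refl) (∣m∣n⇒∣m+n ∣-refl))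

∑<≡∑ᶠ : ∀ n f → ∑< n f ≡ ∑ᶠ {n} (λ i → f (toℕ i))
∑<≡∑ᶠ zero    f = refl
∑<≡∑ᶠ (suc n) f = trans (∑<-suc n f) (cong (_+_ (f 0)) (∑<≡∑ᶠ n (λ x → f (suc x))))

∑<-permute : ∀ n (π ρ : ℕ → ℕ) →
  (∀ {x} → x < n → π x < n) → (∀ {x} → x < n → ρ x < n) →
  (∀ {x} → x < n → ρ (π x) ≡ x) → (∀ {x} → x < n → π (ρ x) ≡ x) →
  ∀ f → ∑< n f ≡ (∑[ x < n ] f (π x))
∑<-permute n π ρ π< ρ< ρπ πρ f = begin
  ∑< n f                            ≡⟨ ∑<≡∑ᶠ n f ⟩
  ∑ᶠ {n} (λ i → f (toℕ i))          ≡⟨ ∑-permute (λ i → f (toℕ i)) σ ⟩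
  ∑ᶠ {n} (λ i → f (toℕ (πᶠ i)))     ≡⟨ sum-cong-≗ (λ i → cong f (toℕ-fromℕ< (π< (toℕ<n i)))) ⟩
  ∑ᶠ {n} (λ i → f (π (toℕ i)))      ≡⟨ ∑<≡∑ᶠ n (λ x → f (π x)) ⟨
  (∑[ x < n ] f (π x))              ∎
  where
  πᶠ ρᶠ : Fin n → Fin n
  πᶠ i = fromℕ< (π< (toℕ<n i))
  ρᶠ i = fromℕ< (ρ< (toℕ<n i))
  σ : Permutation n n
  σ = permutation πᶠ ρᶠ
    (λ i → toℕ-injective (trans (toℕ-fromℕ< _) (trans (cong π (toℕ-fromℕ< _)) (πρ (toℕ<n i)))))
    (λ i → toℕ-injective (trans (toℕ-fromℕ< _) (trans (cong ρ (toℕ-fromℕ< _)) (ρπ (toℕ<n i)))))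

-- Divisor sums and Euler's totient

∑-divisors : ∀ n f → ∑ (divisors n) f ≡ (∑[ x < n ] 𝟙 (suc x ∣? n) * f (suc x))
∑-divisors n f = trans (∑-filter (_∣? n) (range1 n) f) (∑-map suc (upTo n) (λ d → 𝟙 (d ∣? n) * f d))

All-divisors : ∀ {p} {P : ℕ → Set p} n → (∀ d .{{_ : NonZero d}} → d ∣ n → P d) → All P (divisors n)
All-divisors n h = All.zipWith (λ {d} (d∣n , d≢0) → h d {{d≢0}} d∣n)
  (all-filter (_∣? n) (range1 n) , filter⁺ (_∣? n) (map⁺ (All.universal (λ _ → _) (upTo n))))

∑-divisors-cong : ∀ n {f g : ℕ → ℕ} → (∀ d .{{_ : NonZero d}} → d ∣ n → f d ≡ g d) →
  ∑ (divisors n) f ≡ ∑ (divisors n) g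
∑-divisors-cong n e = cong sum (map-cong-local (All-divisors n e))

count-cofactors : ∀ n .{{_ : NonZero n}} x → (∑[ y < n ] 𝟙 (suc x * suc y ≟ n)) ≡ 𝟙 (suc x ∣? n)
count-cofactors n x with suc x ∣? n
... | no x+1∤n = ∑<-zero n λ y _ →
  𝟙-no (suc x * suc y ≟ n) λ eq → x+1∤n (divides (suc y) (trans (sym eq) (*-comm (suc x) (suc y))))
... | yes (divides zero n≡0) = contradiction n≡0 (≢-nonZero⁻¹ n)
... | yes (divides (suc q) n≡q+1*x+1) = begin
  (∑[ y < n ] 𝟙 (suc x * suc y ≟ n))
    ≡⟨ ∑<-cong n (λ y _ → trans (𝟙-cong (suc x * suc y ≟ n) (y ≟ q) cofactor≡q cofactor-q) (sym (*-identityʳ _))) ⟩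
  (∑[ y < n ] 𝟙 (y ≟ q) * 1)
    ≡⟨ ∑<-select n (λ _ → 1) q<n ⟩
  1
    ∎
  where
  cofactor≡q : ∀ {y} → suc x * suc y ≡ n → y ≡ q
  cofactor≡q {y} eq = suc-injective (*-cancelʳ-≡ (suc y) (suc q) (suc x) (trans (*-comm (suc y) (suc x)) (trans eq n≡q+1*x+1)))
  cofactor-q : ∀ {y} → y ≡ q → suc x * suc y ≡ n
  cofactor-q refl = trans (*-comm (suc x) (suc q)) (sym n≡q+1*x+1)
  q<n : q < n
  q<n = ≤-trans (m≤m*n (suc q) (suc x)) (≤-reflexive (sym n≡q+1*x+1))

-- Double counting of the pairs (d , e) with d * e = n.
∑-divisors-complement : ∀ n .{{_ : NonZero n}} f → ∑ (divisors n) f ≡ (∑[ d ∈ divisors n ] f (n div d))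
∑-divisors-complement n f = begin
  ∑ (divisors n) f
    ≡⟨ ∑-divisors n f ⟩
  (∑[ x < n ] 𝟙 (suc x ∣? n) * f (suc x))
    ≡⟨ ∑<-cong n (λ x _ → cong (_* f (suc x)) (count-cofactors n x)) ⟨
  (∑[ x < n ] (∑[ y < n ] 𝟙 (suc x * suc y ≟ n)) * f (suc x))
    ≡⟨ ∑<-cong n (λ x _ → ∑-*ʳ (upTo n) (f (suc x)) _) ⟨
  (∑[ x < n ] ∑[ y < n ] 𝟙 (suc x * suc y ≟ n) * f (suc x))
    ≡⟨ ∑<-cong n (λ x _ → ∑<-cong n (λ y _ → swap-factors x y)) ⟩
  (∑[ x < n ] ∑[ y < n ] 𝟙 (suc y * suc x ≟ n) * f (n ℕ./ suc y))
    ≡⟨ ∑-comm (upTo n) (upTo n) (λ x y → 𝟙 (suc y * suc x ≟ n) * f (n ℕ./ suc y)) ⟩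
  (∑[ y < n ] ∑[ x < n ] 𝟙 (suc y * suc x ≟ n) * f (n ℕ./ suc y))
    ≡⟨ ∑<-cong n (λ y _ → ∑-*ʳ (upTo n) (f (n ℕ./ suc y)) _) ⟩
  (∑[ y < n ] (∑[ x < n ] 𝟙 (suc y * suc x ≟ n)) * f (n ℕ./ suc y))
    ≡⟨ ∑<-cong n (λ y _ → cong (_* f (n ℕ./ suc y)) (count-cofactors n y)) ⟩
  (∑[ y < n ] 𝟙 (suc y ∣? n) * f (n div suc y))
    ≡⟨ ∑-divisors n (λ d → f (n div d)) ⟨
  (∑[ d ∈ divisors n ] f (n div d))
    ∎
  where
  swap-factors : ∀ x y → 𝟙 (suc x * suc y ≟ n) * f (suc x) ≡ 𝟙 (suc y * suc x ≟ n) * f (n ℕ./ suc y)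
  swap-factors x y with suc x * suc y ≟ n | suc y * suc x ≟ n
  ... | yes eq | yes _  = cong (λ t → 1 * f t) (sym (trans (cong (ℕ._/ suc y) (sym eq)) (m*n/n≡m (suc x) (suc y))))
  ... | yes eq | no ≢n  = contradiction (trans (*-comm (suc y) (suc x)) eq) ≢n
  ... | no ≢n  | yes eq = contradiction (trans (*-comm (suc x) (suc y)) eq) ≢n
  ... | no _   | no _   = refl

gcd[n,n]≡gcd[0,n] : ∀ n → gcd n n ≡ gcd 0 n
gcd[n,n]≡gcd[0,n] n = trans (∣-antisym (gcd[m,n]∣m n n) (gcd-greatest ∣-refl ∣-refl)) (sym (gcd-identityˡ n))

φ≡∑< : ∀ n → φ n ≡ (∑[ x < n ] 𝟙 (gcd x n ≟ 1))
φ≡∑< n = begin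
  φ n                                          ≡⟨ length≡∑1 (units n) ⟩
  (∑[ _ ∈ units n ] 1)                         ≡⟨ ∑-filter (λ m → gcd m n ≟ 1) (range1 n) (λ _ → 1) ⟩
  (∑[ m ∈ range1 n ] 𝟙 (gcd m n ≟ 1) * 1)      ≡⟨ ∑-cong (range1 n) (λ m → *-identityʳ _) ⟩
  (∑[ m ∈ range1 n ] 𝟙 (gcd m n ≟ 1))          ≡⟨ ∑-range1 n _ (cong (λ g → 𝟙 (g ≟ 1)) (gcd[n,n]≡gcd[0,n] n)) ⟩
  (∑[ x < n ] 𝟙 (gcd x n ≟ 1))                 ∎

φ-nonZero : ∀ n .{{_ : NonZero n}} → NonZero (φ n)
φ-nonZero (suc n) = subst NonZero (cong length (sym 1∈units)) _
  where
  1∈units : units (suc n) ≡ 1 ∷ filter (λ m → gcd m (suc n) ≟ 1) (map suc (applyUpTo suc n))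
  1∈units = filter-accept (λ m → gcd m (suc n) ≟ 1) (gcd-zeroˡ (suc n))

-- x ↦ x / e is a bijection from {x < G : gcd x G = e} onto {y < G / e : gcd y (G / e) = 1}.
count-gcd≡ : ∀ G .{{_ : NonZero G}} e .{{_ : NonZero e}} →
  (∑[ x < G ] 𝟙 (gcd x G ≟ e)) ≡ 𝟙 (e ∣? G) * φ (G ℕ./ e)
count-gcd≡ G e with e ∣? G
... | no e∤G = ∑<-zero G (λ x _ → 𝟙-no (gcd x G ≟ e) (λ eq → e∤G (subst (_∣ G) eq (gcd[m,n]∣n x G))))
... | yes (divides q G≡q*e) = begin
  (∑[ x < G ] 𝟙 (gcd x G ≟ e))                 ≡⟨ cong (λ m → ∑[ x < m ] 𝟙 (gcd x G ≟ e)) G≡q*e ⟩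
  (∑[ x < q * e ] 𝟙 (gcd x G ≟ e))             ≡⟨ ∑<-cong (q * e) (λ x _ → only-multiples x) ⟩
  (∑[ x < q * e ] 𝟙 (e ∣? x) * 𝟙 (gcd x G ≟ e)) ≡⟨ ∑<-multiples q e (λ x → 𝟙 (gcd x G ≟ e)) ⟩
  (∑[ y < q ] 𝟙 (gcd (y * e) G ≟ e))
    ≡⟨ ∑<-cong q (λ y _ → 𝟙-cong (gcd (y * e) G ≟ e) (gcd y q ≟ 1) (coprime-quotient y) (coprime-multiple y)) ⟩
  (∑[ y < q ] 𝟙 (gcd y q ≟ 1))                 ≡⟨ φ≡∑< q ⟨
  φ q                                          ≡⟨ cong φ (trans (cong (ℕ._/ e) G≡q*e) (m*n/n≡m q e)) ⟨
  φ (G ℕ./ e)                                  ≡⟨ +-identityʳ _ ⟨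
  1 * φ (G ℕ./ e)                              ∎
  where
  only-multiples : ∀ x → 𝟙 (gcd x G ≟ e) ≡ 𝟙 (e ∣? x) * 𝟙 (gcd x G ≟ e)
  only-multiples x with gcd x G ≟ e
  ... | no _    = sym (*-zeroʳ (𝟙 (e ∣? x)))
  ... | yes g≡e = sym (trans (*-identityʳ _) (𝟙-yes (e ∣? x) (subst (_∣ x) g≡e (gcd[m,n]∣m x G))))
  gcd-scaled : ∀ y → gcd (y * e) G ≡ gcd y q * e
  gcd-scaled y = begin
    gcd (y * e) G       ≡⟨ cong (gcd (y * e)) G≡q*e ⟩
    gcd (y * e) (q * e) ≡⟨ cong₂ gcd (*-comm y e) (*-comm q e) ⟩
    gcd (e * y) (e * q) ≡⟨ c*gcd[m,n]≡gcd[cm,cn] e y q ⟨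
    e * gcd y q         ≡⟨ *-comm e _ ⟩
    gcd y q * e         ∎
  coprime-quotient : ∀ y → gcd (y * e) G ≡ e → gcd y q ≡ 1
  coprime-quotient y eq = *-cancelʳ-≡ (gcd y q) 1 e (trans (sym (gcd-scaled y)) (trans eq (sym (*-identityˡ e))))
  coprime-multiple : ∀ y → gcd y q ≡ 1 → gcd (y * e) G ≡ e
  coprime-multiple y eq = trans (gcd-scaled y) (trans (cong (_* e) eq) (*-identityˡ e))

-- Classify x < G by e = gcd x G.
∑-divisors-φ : ∀ G .{{_ : NonZero G}} → ∑ (divisors G) φ ≡ G
∑-divisors-φ G = sym (begin
  G                                             ≡⟨ trans (∑<-const G 1) (*-identityʳ G) ⟨
  (∑[ x < G ] 1)                                ≡⟨ ∑<-cong G (λ x _ → sym (one-gcd x)) ⟩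
  (∑[ x < G ] ∑[ e < G ] 𝟙 (gcd x G ≟ suc e))   ≡⟨ ∑-comm (upTo G) (upTo G) (λ x e → 𝟙 (gcd x G ≟ suc e)) ⟩
  (∑[ e < G ] ∑[ x < G ] 𝟙 (gcd x G ≟ suc e))   ≡⟨ ∑<-cong G (λ e _ → count-gcd≡ G (suc e)) ⟩
  (∑[ e < G ] 𝟙 (suc e ∣? G) * φ (G div suc e)) ≡⟨ ∑-divisors G (λ d → φ (G div d)) ⟨
  (∑[ d ∈ divisors G ] φ (G div d))             ≡⟨ ∑-divisors-complement G φ ⟨
  ∑ (divisors G) φ                              ∎)
  where
  one-gcd : ∀ x → (∑[ e < G ] 𝟙 (gcd x G ≟ suc e)) ≡ 1
  one-gcd x with gcd x G | gcd[m,n]≢0 x G (inj₂ (≢-nonZero⁻¹ G)) | gcd[m,n]≤n x G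
  ... | zero  | g≢0 | _   = contradiction refl g≢0
  ... | suc g | _   | g<G = begin
    (∑[ e < G ] 𝟙 (suc g ≟ suc e))
      ≡⟨ ∑<-cong G (λ e _ → trans (trans (𝟙-≟-suc g e) (𝟙-≟-sym g e)) (sym (*-identityʳ _))) ⟩
    (∑[ e < G ] 𝟙 (e ≟ g) * 1)
      ≡⟨ ∑<-select G (λ _ → 1) g<G ⟩
    1
      ∎

∑-divisors-restrict : ∀ n .{{_ : NonZero n}} G .{{_ : NonZero G}} → G ∣ n → (f : ℕ → ℕ) →
  (∑[ d ∈ divisors n ] 𝟙 (d ∣? G) * f d) ≡ ∑ (divisors G) f
∑-divisors-restrict n G G∣n f = begin
  (∑[ d ∈ divisors n ] 𝟙 (d ∣? G) * f d)                       ≡⟨ ∑-divisors n _ ⟩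
  (∑[ x < n ] 𝟙 (suc x ∣? n) * (𝟙 (suc x ∣? G) * f (suc x)))   ≡⟨ ∑<-cong n (λ x _ → drop-∣n x) ⟩
  ∑< n h                                                       ≡⟨ cong (λ m → ∑< m h) (m+[n∸m]≡n G≤n) ⟨
  ∑< (G + (n ∸ G)) h                                           ≡⟨ ∑<-+ G (n ∸ G) h ⟩
  ∑< G h + (∑[ x < n ∸ G ] h (G + x))                          ≡⟨ cong (_+_ (∑< G h)) (∑<-zero (n ∸ G) λ x _ → beyond-G x) ⟩
  ∑< G h + 0                                                   ≡⟨ +-identityʳ _ ⟩
  ∑< G h                                                       ≡⟨ ∑-divisors G f ⟨
  ∑ (divisors G) f                                             ∎
  where
  h : ℕ → ℕ
  h x = 𝟙 (suc x ∣? G) * f (suc x)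
  G≤n : G ≤ n
  G≤n = ∣⇒≤ G∣n
  drop-∣n : ∀ x → 𝟙 (suc x ∣? n) * (𝟙 (suc x ∣? G) * f (suc x)) ≡ h x
  drop-∣n x with suc x ∣? G
  ... | no _      = *-zeroʳ (𝟙 (suc x ∣? n))
  ... | yes x+1∣G = trans (cong (_* (1 * f (suc x))) (𝟙-yes (suc x ∣? n) (∣-trans x+1∣G G∣n))) (+-identityʳ _)
  beyond-G : ∀ x → h (G + x) ≡ 0
  beyond-G x = cong (_* f (suc (G + x))) (𝟙-no (suc (G + x) ∣? G) (>⇒∤ (s≤s (m≤m+n G x))))

∑-divisors-∣-φ : ∀ n .{{_ : NonZero n}} G → G ∣ n → (∑[ d ∈ divisors n ] 𝟙 (d ∣? G) * φ d) ≡ G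
∑-divisors-∣-φ n G G∣n = trans (∑-divisors-restrict n G G∣n φ) (∑-divisors-φ G)
  where
  instance
    G-nonZero : NonZero G
    G-nonZero = ≢-nonZero λ G≡0 → ≢-nonZero⁻¹ n (0∣⇒≡0 (subst (_∣ n) G≡0 G∣n))

-- Units modulo n

%-cong-* : ∀ d .{{_ : NonZero d}} {a b x y} → a % d ≡ b % d → x % d ≡ y % d → (a * x) % d ≡ (b * y) % d
%-cong-* d {a} {b} {x} {y} a≡b x≡y = begin
  (a * x) % d               ≡⟨ %-distribˡ-* a x d ⟩
  (a % d * (x % d)) % d     ≡⟨ cong₂ (λ s t → (s * t) % d) a≡b x≡y ⟩
  (b % d * (y % d)) % d     ≡⟨ %-distribˡ-* b y d ⟨
  (b * y) % d               ∎

%-cong-∣ : ∀ {a b d n} .{{_ : NonZero d}} .{{_ : NonZero n}} → d ∣ n → a % n ≡ b % n → a % d ≡ b % d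
%-cong-∣ {a} {b} {d} {n} d∣n a≡b = begin
  a % d        ≡⟨ m∣n⇒o%n%m≡o%m d n a d∣n ⟨
  a % n % d    ≡⟨ cong (_% d) a≡b ⟩
  b % n % d    ≡⟨ m∣n⇒o%n%m≡o%m d n b d∣n ⟩
  b % d        ∎

coprime-%⁺ : ∀ {x} n .{{_ : NonZero n}} → Coprime x n → Coprime (x % n) n
coprime-%⁺ n x⊥n (i∣x%n , i∣n) = x⊥n (∣n∣m%n⇒∣m i∣n i∣x%n , i∣n)

coprime-%⁻ : ∀ {x} n .{{_ : NonZero n}} → Coprime (x % n) n → Coprime x n
coprime-%⁻ n x%n⊥n (i∣x , i∣n) = x%n⊥n (%-presˡ-∣ i∣x i∣n , i∣n)

coprime-∣ʳ : ∀ {x d n} → d ∣ n → Coprime x n → Coprime x d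
coprime-∣ʳ d∣n x⊥n (i∣x , i∣d) = x⊥n (i∣x , ∣-trans i∣d d∣n)

coprime-*⁺ : ∀ {u x n} → Coprime u n → Coprime x n → Coprime (u * x) n
coprime-*⁺ {u} {x} {n} u⊥n x⊥n {i} (i∣ux , i∣n) = x⊥n (coprime-divisor i⊥u i∣ux , i∣n)
  where
  i⊥u : Coprime i u
  i⊥u (j∣i , j∣u) = u⊥n (j∣u , ∣-trans j∣i i∣n)

coprime-*⁻ : ∀ {u x n} → Coprime (u * x) n → Coprime x n
coprime-*⁻ {u} ux⊥n (i∣x , i∣n) = ux⊥n (∣n⇒∣m*n u i∣x , i∣n)

unit-inverse : ∀ {u} n .{{_ : NonZero n}} → Coprime u n → ∃ λ v → (v * u) % n ≡ 1 % n
unit-inverse {u} (suc n-1) u⊥n with coprime-Bézout u⊥n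
... | Bézout.+- x y 1+yn≡xu = x , (begin
  (x * u) % n              ≡⟨ cong (_% n) 1+yn≡xu ⟨
  (1 + y * n) % n          ≡⟨ [m+kn]%n≡m%n 1 y n ⟩
  1 % n                    ∎)
  where
  n : ℕ
  n = suc n-1
-- Here 1 + x u ≡ 0, so (n - 1) x u ≡ -(n - 1) ≡ 1 (mod n).
... | Bézout.-+ x y 1+xu≡yn = n-1 * x , (begin
  (n-1 * x * u) % n        ≡⟨ [m+n]%n≡m%n (n-1 * x * u) n ⟨
  (n-1 * x * u + n) % n    ≡⟨ cong (_% n) multiple ⟩
  (1 + n-1 * y * n) % n    ≡⟨ [m+kn]%n≡m%n 1 (n-1 * y) n ⟩
  1 % n                    ∎)
  where
  n : ℕ
  n = suc n-1
  multiple : n-1 * x * u + n ≡ 1 + n-1 * y * n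
  multiple = begin
    n-1 * x * u + suc n-1      ≡⟨ rearrange n-1 x u ⟩
    1 + n-1 * (1 + x * u)      ≡⟨ cong (λ t → 1 + n-1 * t) 1+xu≡yn ⟩
    1 + n-1 * (y * n)          ≡⟨ cong (_+_ 1) (*-assoc n-1 y n) ⟨
    1 + n-1 * y * n            ∎
    where
    rearrange : ∀ m a b → m * a * b + suc m ≡ 1 + m * (1 + a * b)
    rearrange = solve-∀

IsCoprimePart : ℕ → ℕ → ℕ → Set
IsCoprimePart c n s = s ∣ n × Coprime s c × (∀ {q} → q ∣ n → Coprime q c → q ∣ s)

isCoprimePart-* : ∀ {c g m s} → g ∣ c → IsCoprimePart c m s → IsCoprimePart c (g * m) s
isCoprimePart-* {g = g} g∣c (s∣m , s⊥c , maximal) = ∣-trans s∣m (n∣m*n g) , s⊥c , λ q∣gm q⊥c →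
  maximal (coprime-divisor (λ (i∣q , i∣g) → q⊥c (i∣q , ∣-trans i∣g g∣c)) q∣gm) q⊥c

coprimePart : ∀ c n .{{_ : NonZero n}} → Σ ℕ (IsCoprimePart c n)
coprimePart c n = go n (<-wellFounded n)
  where
  go : ∀ m .{{_ : NonZero m}} → Acc _<_ m → Σ ℕ (IsCoprimePart c m)
  go m (acc rec) with gcd m c ≟ 1
  ... | yes g≡1 = m , ∣-refl , gcd≡1⇒coprime g≡1 , (λ q∣m _ → q∣m)
  ... | no  g≢1 = s , subst (λ t → IsCoprimePart c t s) (m*[n/m]≡n (gcd[m,n]∣m m c))
                         (isCoprimePart-* (gcd[m,n]∣n m c) part)
    where
    g : ℕ
    g = gcd m c
    instance
      g-nonZero : NonZero g
      g-nonZero = ≢-nonZero (gcd[m,n]≢0 m c (inj₁ (≢-nonZero⁻¹ m)))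
      m/g-nonZero : NonZero (m ℕ./ g)
      m/g-nonZero = ≢-nonZero (m/gcd[m,n]≢0 m c)
    1<g : 1 < g
    1<g = ≤∧≢⇒< (>-nonZero⁻¹ g) (g≢1 ∘ sym)
    s : ℕ
    s = proj₁ (go (m ℕ./ g) (rec (m/n<m m g 1<g)))
    part : IsCoprimePart c (m ℕ./ g) s
    part = proj₂ (go (m ℕ./ g) (rec (m/n<m m g 1<g)))

-- u = c + s d, with s the part of n coprime to c: a common factor of u and n is coprime to c
-- (it would otherwise meet d), hence divides s, hence divides c.
unit-lift : ∀ {c d} n .{{_ : NonZero n}} .{{_ : NonZero d}} → d ∣ n → Coprime c d →
  ∃ λ u → Coprime u n × u % d ≡ c % d
unit-lift {c} {d} n d∣n c⊥d with coprimePart c n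
... | s , _ , s⊥c , maximal = c + s * d , u⊥n , [m+kn]%n≡m%n c s d
  where
  u⊥n : Coprime (c + s * d) n
  u⊥n {i} (i∣u , i∣n) = i⊥c (∣-refl , i∣c)
    where
    i⊥c : Coprime i c
    i⊥c {j} (j∣i , j∣c) = c⊥d (j∣c , coprime-divisor j⊥s (∣m+n∣m⇒∣n (∣-trans j∣i i∣u) j∣c))
      where
      j⊥s : Coprime j s
      j⊥s (k∣j , k∣s) = s⊥c (k∣s , ∣-trans k∣j j∣c)
    i∣c : i ∣ c
    i∣c = ∣m+n∣m⇒∣n (subst (i ∣_) (+-comm c (s * d)) i∣u) (∣m⇒∣m*n d (maximal i∣n i⊥c))

∑<-unit-permute : ∀ n .{{_ : NonZero n}} {u v} → (v * u) % n ≡ 1 % n →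
  ∀ f → ∑< n f ≡ (∑[ x < n ] f ((u * x) % n))
∑<-unit-permute n {u} {v} vu≡1 f =
  ∑<-permute n (λ x → (u * x) % n) (λ x → (v * x) % n) (λ _ → m%n<n _ n) (λ _ → m%n<n _ n)
    (cancel v u vu≡1) (cancel u v (trans (cong (_% n) (*-comm u v)) vu≡1)) f
  where
  cancel : ∀ a b → (a * b) % n ≡ 1 % n → ∀ {x} → x < n → (a * ((b * x) % n)) % n ≡ x
  cancel a b ab≡1 {x} x<n = begin
    (a * ((b * x) % n)) % n   ≡⟨ %-cong-* n {a} {a} {(b * x) % n} {b * x} refl (m%n%n≡m%n (b * x) n) ⟩
    (a * (b * x)) % n         ≡⟨ cong (_% n) (*-assoc a b x) ⟨
    (a * b * x) % n           ≡⟨ %-cong-* n {a * b} {1} {x} {x} ab≡1 refl ⟩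
    (1 * x) % n               ≡⟨ cong (_% n) (*-identityˡ x) ⟩
    x % n                     ≡⟨ m<n⇒m%n≡m x<n ⟩
    x                         ∎

-- The value at d = 0 is junk: only divisors of n occur.
unitsCongruent : ℕ → ℕ → ℕ → ℕ
unitsCongruent n zero        c = 0
unitsCongruent n d@(suc _)   c = ∑[ x < n ] 𝟙 (gcd x n ≟ 1) * 𝟙 (x % d ≟ c % d)

-- Multiplication by a unit u ≡ c (mod d) permutes the units mod n and maps the class of 1 onto that of c.
unitsCongruent-invariant : ∀ n .{{_ : NonZero n}} d .{{_ : NonZero d}} → d ∣ n →
  ∀ {c} → Coprime c d → unitsCongruent n d c ≡ unitsCongruent n d 1
unitsCongruent-invariant n d@(suc _) d∣n {c} c⊥d with unit-lift n d∣n c⊥d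
... | u , u⊥n , u≡c with unit-inverse n u⊥n
... | v , vu≡1 = begin
  unitsCongruent n d c
    ≡⟨ ∑<-unit-permute n {u} {v} vu≡1 (λ x → 𝟙 (gcd x n ≟ 1) * 𝟙 (x % d ≟ c % d)) ⟩
  (∑[ x < n ] 𝟙 (gcd ((u * x) % n) n ≟ 1) * 𝟙 ((u * x) % n % d ≟ c % d))
    ≡⟨ ∑<-cong n (λ x _ → cong₂ _*_ (unit-invariant x) (class-shift x)) ⟩
  unitsCongruent n d 1
    ∎
  where
  unit-invariant : ∀ x → 𝟙 (gcd ((u * x) % n) n ≟ 1) ≡ 𝟙 (gcd x n ≟ 1)
  unit-invariant x = 𝟙-cong (gcd ((u * x) % n) n ≟ 1) (gcd x n ≟ 1)
    (λ g≡1 → coprime⇒gcd≡1 (coprime-*⁻ {u} (coprime-%⁻ n (gcd≡1⇒coprime g≡1))))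
    (λ g≡1 → coprime⇒gcd≡1 (coprime-%⁺ n (coprime-*⁺ u⊥n (gcd≡1⇒coprime g≡1))))
  vu≡1[d] : (v * u) % d ≡ 1 % d
  vu≡1[d] = %-cong-∣ d∣n vu≡1
  class-shift : ∀ x → 𝟙 ((u * x) % n % d ≟ c % d) ≡ 𝟙 (x % d ≟ 1 % d)
  class-shift x = trans (cong (λ r → 𝟙 (r ≟ c % d)) (m∣n⇒o%n%m≡o%m d n (u * x) d∣n))
    (𝟙-cong ((u * x) % d ≟ c % d) (x % d ≟ 1 % d) to from)
    where
    from : x % d ≡ 1 % d → (u * x) % d ≡ c % d
    from x≡1 = trans (%-cong-* d {u} {u} {x} {1} refl x≡1) (trans (cong (_% d) (*-identityʳ u)) u≡c)
    to : (u * x) % d ≡ c % d → x % d ≡ 1 % d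
    to ux≡c = begin
      x % d             ≡⟨ cong (_% d) (*-identityˡ x) ⟨
      (1 * x) % d       ≡⟨ %-cong-* d {v * u} {1} {x} {x} vu≡1[d] refl ⟨
      (v * u * x) % d   ≡⟨ cong (_% d) (*-assoc v u x) ⟩
      (v * (u * x)) % d ≡⟨ %-cong-* d {v} {v} {u * x} {u} refl (trans ux≡c (sym u≡c)) ⟩
      (v * u) % d       ≡⟨ vu≡1[d] ⟩
      1 % d             ∎

φ-factor : ∀ n .{{_ : NonZero n}} d .{{_ : NonZero d}} → d ∣ n → φ n ≡ φ d * unitsCongruent n d 1
φ-factor n d@(suc _) d∣n = begin
  φ n                                               ≡⟨ φ≡∑< n ⟩
  (∑[ x < n ] unit x)                               ≡⟨ ∑<-cong n (λ x _ → sym (split-by-residue x)) ⟩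
  (∑[ x < n ] ∑[ c < d ] unit[d] c * inClass x c)   ≡⟨ ∑-comm (upTo n) (upTo d) (λ x c → unit[d] c * inClass x c) ⟩
  (∑[ c < d ] ∑[ x < n ] unit[d] c * inClass x c)   ≡⟨ ∑<-cong d (λ c _ → ∑-*ˡ (upTo n) (unit[d] c) (λ x → inClass x c)) ⟩
  (∑[ c < d ] unit[d] c * unitsCongruent n d c)     ≡⟨ ∑<-cong d (λ c _ → unit-classes-equal c (gcd c d ≟ 1)) ⟩
  (∑[ c < d ] unit[d] c * unitsCongruent n d 1)     ≡⟨ ∑-*ʳ (upTo d) (unitsCongruent n d 1) unit[d] ⟩
  (∑[ c < d ] unit[d] c) * unitsCongruent n d 1     ≡⟨ cong (_* unitsCongruent n d 1) (φ≡∑< d) ⟨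
  φ d * unitsCongruent n d 1                        ∎
  where
  unit unit[d] : ℕ → ℕ
  unit x = 𝟙 (gcd x n ≟ 1)
  unit[d] c = 𝟙 (gcd c d ≟ 1)
  inClass : ℕ → ℕ → ℕ
  inClass x c = unit x * 𝟙 (x % d ≟ c % d)
  unit-classes-equal : ∀ c (c⊥?d : Dec (gcd c d ≡ 1)) →
    𝟙 c⊥?d * unitsCongruent n d c ≡ 𝟙 c⊥?d * unitsCongruent n d 1
  unit-classes-equal c (yes c⊥d) = cong (1 *_) (unitsCongruent-invariant n d d∣n {c} (gcd≡1⇒coprime c⊥d))
  unit-classes-equal c (no _)    = refl
  split-by-residue : ∀ x → (∑[ c < d ] unit[d] c * inClass x c) ≡ unit x
  split-by-residue x = begin
    (∑[ c < d ] unit[d] c * inClass x c)              ≡⟨ ∑<-cong d (λ c c<d → reorder c c<d) ⟩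
    (∑[ c < d ] 𝟙 (c ≟ x % d) * (unit[d] c * unit x)) ≡⟨ ∑<-select d (λ c → unit[d] c * unit x) (m%n<n x d) ⟩
    unit[d] (x % d) * unit x                          ≡⟨ residue-unit (gcd x n ≟ 1) ⟩
    unit x                                            ∎
    where
    reorder : ∀ c → c < d → unit[d] c * inClass x c ≡ 𝟙 (c ≟ x % d) * (unit[d] c * unit x)
    reorder c c<d = begin
      unit[d] c * (unit x * 𝟙 (x % d ≟ c % d))
        ≡⟨ cong (λ i → unit[d] c * (unit x * i)) (trans (𝟙-≟-sym (x % d) (c % d)) (cong (λ t → 𝟙 (t ≟ x % d)) (m<n⇒m%n≡m c<d))) ⟩
      unit[d] c * (unit x * 𝟙 (c ≟ x % d))
        ≡⟨ rearrange (unit[d] c) (unit x) (𝟙 (c ≟ x % d)) ⟩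
      𝟙 (c ≟ x % d) * (unit[d] c * unit x)
        ∎
      where
      rearrange : ∀ a b i → a * (b * i) ≡ i * (a * b)
      rearrange = solve-∀
    residue-unit : (x⊥?n : Dec (gcd x n ≡ 1)) → unit[d] (x % d) * 𝟙 x⊥?n ≡ 𝟙 x⊥?n
    residue-unit (no _)    = *-zeroʳ (unit[d] (x % d))
    residue-unit (yes x⊥n) = trans (*-identityʳ _)
      (𝟙-yes (gcd (x % d) d ≟ 1) (coprime⇒gcd≡1 (coprime-%⁺ {x} d (coprime-∣ʳ d∣n (gcd≡1⇒coprime x⊥n)))))

-- Residues of integers

residues-equal : ∀ {r s d} .{{_ : NonZero d}} → r < d → s < d → d ∣ ∣ + r ℤ.- + s ∣ → r ≡ s
residues-equal {r} {s} {d} r<d s<d d∣r-s = ℤ.+-injective (ℤ.i-j≡0⇒i≡j (+ r) (+ s) (ℤ.∣i∣≡0⇒i≡0 ∣r-s∣≡0))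
  where
  ∣r-s∣<d : ∣ + r ℤ.- + s ∣ < d
  ∣r-s∣<d = ≤-<-trans (subst (_≤ r ⊔ s) (cong ∣_∣ (sym (ℤ.m-n≡m⊖n r s))) (ℤ.∣m⊝n∣≤m⊔n r s))
                      (⊔-pres-<m r<d s<d)
  ∣r-s∣≡0 : ∣ + r ℤ.- + s ∣ ≡ 0
  ∣r-s∣≡0 = trans (sym (m<n⇒m%n≡m ∣r-s∣<d)) (n∣m⇒m%n≡0 _ d d∣r-s)

module _ (i j : ℤ) (d : ℕ) .{{_ : NonZero d}} where

  private
    r s : ℕ
    r = i %ℕ d
    s = j %ℕ d
    difference : i ℤ.- j ≡ (+ r ℤ.- + s) ℤ.+ (i /ℕ d ℤ.- j /ℕ d) ℤ.* + d
    difference = begin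
      i ℤ.- j
        ≡⟨ cong₂ ℤ._-_ (a≡a%ℕn+[a/ℕn]*n i d) (a≡a%ℕn+[a/ℕn]*n j d) ⟩
      (+ r ℤ.+ i /ℕ d ℤ.* + d) ℤ.- (+ s ℤ.+ j /ℕ d ℤ.* + d)
        ≡⟨ regroup (+ r) (+ s) (i /ℕ d) (j /ℕ d) (+ d) ⟩
      (+ r ℤ.- + s) ℤ.+ (i /ℕ d ℤ.- j /ℕ d) ℤ.* + d
        ∎
      where
      regroup : ∀ R S P Q D → (R ℤ.+ P ℤ.* D) ℤ.- (S ℤ.+ Q ℤ.* D) ≡ (R ℤ.- S) ℤ.+ (P ℤ.- Q) ℤ.* D
      regroup = ℤ-solve-∀

  ∣∣i-j∣⇒%ℕ≡ : d ∣ ∣ i ℤ.- j ∣ → i %ℕ d ≡ j %ℕ d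
  ∣∣i-j∣⇒%ℕ≡ d∣i-j = residues-equal (n%ℕd<d i d) (n%ℕd<d j d) (ℤ∣.∣⇒∣ᵤ (ℤ∣.∣m+n∣n⇒∣m {m = + r ℤ.- + s}
    (subst (+ d ∣ℤ_) difference (ℤ∣.∣ᵤ⇒∣ d∣i-j))
    (ℤ∣.∣n⇒∣m*n (i /ℕ d ℤ.- j /ℕ d) ℤ∣.∣-refl)))

  %ℕ≡⇒∣∣i-j∣ : i %ℕ d ≡ j %ℕ d → d ∣ ∣ i ℤ.- j ∣
  %ℕ≡⇒∣∣i-j∣ r≡s = ℤ∣.∣⇒∣ᵤ (subst (+ d ∣ℤ_) (sym difference)
    (ℤ∣.∣m∣n⇒∣m+n d∣r-s (ℤ∣.∣n⇒∣m*n (i /ℕ d ℤ.- j /ℕ d) ℤ∣.∣-refl)))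
    where
    d∣r-s : + d ∣ℤ (+ r ℤ.- + s)
    d∣r-s = subst (λ t → + d ∣ℤ (+ r ℤ.- + t)) r≡s
      (subst (+ d ∣ℤ_) (sym (ℤ.+-inverseʳ (+ r))) (ℤ∣.divides (+ 0) refl))

∑-units-congruent : ∀ n .{{_ : NonZero n}} d .{{_ : NonZero d}} → d ∣ n →
  ∀ a → Coprime ∣ a ∣ n → (∑[ m ∈ units n ] 𝟙 (d ∣? ∣ + m ℤ.- a ∣)) ≡ unitsCongruent n d 1
∑-units-congruent n d@(suc _) d∣n a a⊥n = begin
  (∑[ m ∈ units n ] 𝟙 (d ∣? ∣ + m ℤ.- a ∣))
    ≡⟨ ∑-filter (λ m → gcd m n ≟ 1) (range1 n) _ ⟩
  (∑[ m ∈ range1 n ] 𝟙 (gcd m n ≟ 1) * 𝟙 (d ∣? ∣ + m ℤ.- a ∣))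
    ≡⟨ ∑-cong (range1 n) (λ m → cong (𝟙 (gcd m n ≟ 1) *_) (𝟙-cong (d ∣? _) (m % d ≟ α % d)
         (λ d∣m-a → trans (∣∣i-j∣⇒%ℕ≡ (+ m) a d d∣m-a) α≡α%d)
         (λ m≡α → %ℕ≡⇒∣∣i-j∣ (+ m) a d (trans m≡α (sym α≡α%d))))) ⟩
  (∑[ m ∈ range1 n ] 𝟙 (gcd m n ≟ 1) * 𝟙 (m % d ≟ α % d))
    ≡⟨ ∑-range1 n _ (cong₂ (λ g r → 𝟙 (g ≟ 1) * 𝟙 (r ≟ α % d))
         (gcd[n,n]≡gcd[0,n] n) (trans (n∣m⇒m%n≡0 n d d∣n) (sym (m*n%n≡0 0 d)))) ⟩
  unitsCongruent n d α
    ≡⟨ unitsCongruent-invariant n d d∣n α⊥d ⟩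
  unitsCongruent n d 1
    ∎
  where
  α : ℕ
  α = a %ℕ d
  α≡α%d : α ≡ α % d
  α≡α%d = sym (m<n⇒m%n≡m (n%ℕd<d a d))
  α⊥d : Coprime α d
  α⊥d {i} (i∣α , i∣d) = a⊥n (i∣a , ∣-trans i∣d d∣n)
    where
    d∣a-α : d ∣ ∣ a ℤ.- + α ∣
    d∣a-α = %ℕ≡⇒∣∣i-j∣ a (+ α) d α≡α%d
    i∣a : i ∣ ∣ a ∣
    i∣a = ℤ∣.∣⇒∣ᵤ (subst (+ i ∣ℤ_) (cancel a (+ α))
      (ℤ∣.∣m∣n⇒∣m+n (ℤ∣.∣ᵤ⇒∣ {+ i} {a ℤ.- + α} (∣-trans i∣d d∣a-α))
                    (ℤ∣.∣ᵤ⇒∣ {+ i} {+ α} i∣α)))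
      where
      cancel : ∀ A B → (A ℤ.- B) ℤ.+ B ≡ A
      cancel = ℤ-solve-∀

-- The left-hand side as a divisor sum

𝟙-∣-gcdList : ∀ d xs → 𝟙 (d ∣? gcdList xs) ≡ product (map (λ x → 𝟙 (d ∣? x)) xs)
𝟙-∣-gcdList d []       = 𝟙-yes (d ∣? 0) (d ∣0)
𝟙-∣-gcdList d (x ∷ xs) = trans (𝟙-∣-gcd (d ∣? x) (d ∣? gcdList xs)) (cong (𝟙 (d ∣? x) *_) (𝟙-∣-gcdList d xs))
  where
  𝟙-∣-gcd : (d∣?x : Dec (d ∣ x)) (d∣?g : Dec (d ∣ gcdList xs)) →
    𝟙 (d ∣? gcd x (gcdList xs)) ≡ 𝟙 d∣?x * 𝟙 d∣?g
  𝟙-∣-gcd (yes d∣x) (yes d∣g) = 𝟙-yes (d ∣? _) (gcd-greatest d∣x d∣g)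
  𝟙-∣-gcd (yes _)   (no d∤g)  = 𝟙-no (d ∣? _) (λ d∣gcd → d∤g (∣-trans d∣gcd (gcd[m,n]∣n x _)))
  𝟙-∣-gcd (no d∤x)  _         = 𝟙-no (d ∣? _) (λ d∣gcd → d∤x (∣-trans d∣gcd (gcd[m,n]∣m x _)))

gcdList-++-∣ : ∀ n xs → gcdList (xs ++ n ∷ []) ∣ n
gcdList-++-∣ n []       = ∣-reflexive (gcd-identityʳ n)
gcdList-++-∣ n (x ∷ xs) = ∣-trans (gcd[m,n]∣n x _) (gcdList-++-∣ n xs)

∑-tuples-suc : ∀ k (xs : List ℕ) (f : Vec ℕ (suc k) → ℕ) →
  ∑ (tuples (suc k) xs) f ≡ (∑[ x ∈ xs ] ∑[ ms ∈ tuples k xs ] f (x ∷ ms))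
∑-tuples-suc k xs f = trans (∑-concatMap (λ x → map (x ∷_) (tuples k xs)) xs f)
  (∑-cong xs (λ x → ∑-map (x ∷_) (tuples k xs) f))

∑-tuples-∏ : ∀ k (xs : List ℕ) (w : ℕ → ℕ) → (∑[ ms ∈ tuples k xs ] product (map w (toList ms))) ≡ ∑ xs w ^ k
∑-tuples-∏ zero    xs w = refl
∑-tuples-∏ (suc k) xs w = begin
  (∑[ ms ∈ tuples (suc k) xs ] product (map w (toList ms)))
    ≡⟨ ∑-tuples-suc k xs _ ⟩
  (∑[ x ∈ xs ] ∑[ ms ∈ tuples k xs ] w x * product (map w (toList ms)))
    ≡⟨ ∑-cong xs (λ x → ∑-*ˡ (tuples k xs) (w x) _) ⟩
  (∑[ x ∈ xs ] w x * (∑[ ms ∈ tuples k xs ] product (map w (toList ms))))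
    ≡⟨ ∑-cong xs (λ x → cong (w x *_) (∑-tuples-∏ k xs w)) ⟩
  (∑[ x ∈ xs ] w x * ∑ xs w ^ k)
    ≡⟨ ∑-*ʳ xs (∑ xs w ^ k) w ⟩
  ∑ xs w * ∑ xs w ^ k
    ∎

∑-tuples-∏-zipWith : ∀ {B : Set} k (xs : List ℕ) (g : ℕ → B → ℕ) (w : ℕ → ℕ) (bs : Vec B k) K →
  (∀ i → (∑[ x ∈ xs ] w (g x (lookup bs i))) ≡ K) →
  (∑[ ms ∈ tuples k xs ] product (map w (toList (zipWith g ms bs)))) ≡ K ^ k
∑-tuples-∏-zipWith zero    xs g w []       K each≡K = refl
∑-tuples-∏-zipWith (suc k) xs g w (b ∷ bs) K each≡K = begin
  (∑[ ms ∈ tuples (suc k) xs ] product (map w (toList (zipWith g ms (b ∷ bs)))))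
    ≡⟨ ∑-tuples-suc k xs _ ⟩
  (∑[ x ∈ xs ] ∑[ ms ∈ tuples k xs ] w (g x b) * product (map w (toList (zipWith g ms bs))))
    ≡⟨ ∑-cong xs (λ x → ∑-*ˡ (tuples k xs) (w (g x b)) _) ⟩
  (∑[ x ∈ xs ] w (g x b) * (∑[ ms ∈ tuples k xs ] product (map w (toList (zipWith g ms bs)))))
    ≡⟨ ∑-cong xs (λ x → cong (w (g x b) *_) (∑-tuples-∏-zipWith k xs g w bs K (λ i → each≡K (Fin.suc i)))) ⟩
  (∑[ x ∈ xs ] w (g x b) * K ^ k)
    ≡⟨ ∑-*ʳ xs (K ^ k) (λ x → w (g x b)) ⟩
  (∑[ x ∈ xs ] w (g x b)) * K ^ k
    ≡⟨ cong (_* K ^ k) (each≡K Fin.zero) ⟩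
  K * K ^ k
    ∎

∑-range1-multiples : ∀ n d .{{_ : NonZero d}} → d ∣ n → (∑[ b ∈ range1 n ] 𝟙 (d ∣? b)) ≡ n ℕ./ d
∑-range1-multiples n d d∣n@(divides q n≡q*d) = begin
  (∑[ b ∈ range1 n ] 𝟙 (d ∣? b))      ≡⟨ ∑-range1 n _ (trans (𝟙-yes (d ∣? n) d∣n) (sym (𝟙-yes (d ∣? 0) (d ∣0)))) ⟩
  (∑[ b < n ] 𝟙 (d ∣? b))             ≡⟨ cong (λ m → ∑[ b < m ] 𝟙 (d ∣? b)) n≡q*d ⟩
  (∑[ b < q * d ] 𝟙 (d ∣? b))         ≡⟨ ∑<-cong (q * d) (λ b _ → sym (*-identityʳ _)) ⟩
  (∑[ b < q * d ] 𝟙 (d ∣? b) * 1)     ≡⟨ ∑<-multiples q d (λ _ → 1) ⟩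
  (∑[ _ < q ] 1)                      ≡⟨ trans (∑<-const q 1) (*-identityʳ q) ⟩
  q                                   ≡⟨ trans (cong (ℕ._/ d) n≡q*d) (m*n/n≡m q d) ⟨
  n ℕ./ d                             ∎

divisorTerm : ℕ → ℕ → ℕ → ℕ → ℕ
divisorTerm k r n d = φ d * unitsCongruent n d 1 ^ k * (n div d) ^ r

lhs≡∑-divisors : ∀ k r n .{{_ : NonZero n}} (a : Vec ℤ k) → (∀ i → Coprime ∣ lookup a i ∣ n) →
  lhs k r n a ≡ ∑ (divisors n) (divisorTerm k r n)
lhs≡∑-divisors k r n a a⊥n = begin
  lhs k r n a
    ≡⟨ cong sum (map-id (concatMap (λ ms → map (G ms) Bs) Ms)) ⟨
  ∑ (concatMap (λ ms → map (G ms) Bs) Ms) (λ g → g)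
    ≡⟨ ∑-concatMap (λ ms → map (G ms) Bs) Ms (λ g → g) ⟩
  (∑[ ms ∈ Ms ] ∑ (map (G ms) Bs) (λ g → g))
    ≡⟨ ∑-cong Ms (λ ms → ∑-map (G ms) Bs (λ g → g)) ⟩
  (∑[ ms ∈ Ms ] ∑[ bs ∈ Bs ] G ms bs)
    ≡⟨ ∑-cong Ms (λ ms → ∑-cong Bs (λ bs → sym (∑-divisors-∣-φ n (G ms bs) (G∣n ms bs)))) ⟩
  (∑[ ms ∈ Ms ] ∑[ bs ∈ Bs ] ∑[ d ∈ divisors n ] 𝟙 (d ∣? G ms bs) * φ d)
    ≡⟨ ∑-cong Ms (λ ms → ∑-cong Bs (λ bs → ∑-divisors-cong n (λ d d∣n → factorise d d∣n ms bs))) ⟩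
  (∑[ ms ∈ Ms ] ∑[ bs ∈ Bs ] ∑[ d ∈ divisors n ] T d ms bs)
    ≡⟨ ∑-cong Ms (λ ms → ∑-comm Bs (divisors n) (λ bs d → T d ms bs)) ⟩
  (∑[ ms ∈ Ms ] ∑[ d ∈ divisors n ] ∑[ bs ∈ Bs ] T d ms bs)
    ≡⟨ ∑-comm Ms (divisors n) (λ ms d → ∑[ bs ∈ Bs ] T d ms bs) ⟩
  (∑[ d ∈ divisors n ] ∑[ ms ∈ Ms ] ∑[ bs ∈ Bs ] T d ms bs)
    ≡⟨ ∑-divisors-cong n count ⟩
  ∑ (divisors n) (divisorTerm k r n)
    ∎
  where
  Ms : List (Vec ℕ k)
  Ms = tuples k (units n)
  Bs : List (Vec ℕ r)
  Bs = tuples r (range1 n)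
  differences : Vec ℕ k → List ℕ
  differences ms = toList (zipWith (λ m aᵢ → ∣ + m ℤ.- aᵢ ∣) ms a)
  G : Vec ℕ k → Vec ℕ r → ℕ
  G ms bs = gcdList (differences ms ++ toList bs ++ n ∷ [])
  ∏∣ : ℕ → List ℕ → ℕ
  ∏∣ d xs = product (map (λ x → 𝟙 (d ∣? x)) xs)
  T : ℕ → Vec ℕ k → Vec ℕ r → ℕ
  T d ms bs = φ d * ∏∣ d (differences ms) * ∏∣ d (toList bs)

  G∣n : ∀ ms bs → G ms bs ∣ n
  G∣n ms bs = subst (λ xs → gcdList xs ∣ n) (++-assoc (differences ms) (toList bs) (n ∷ []))
    (gcdList-++-∣ n (differences ms ++ toList bs))

  factorise : ∀ d → d ∣ n → ∀ ms bs → 𝟙 (d ∣? G ms bs) * φ d ≡ T d ms bs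
  factorise d d∣n ms bs = begin
    𝟙 (d ∣? G ms bs) * φ d
      ≡⟨ cong (_* φ d) (𝟙-∣-gcdList d (differences ms ++ toList bs ++ n ∷ [])) ⟩
    ∏∣ d (differences ms ++ toList bs ++ n ∷ []) * φ d
      ≡⟨ cong (_* φ d) (∏∣-++ (differences ms) _) ⟩
    ∏∣ d (differences ms) * ∏∣ d (toList bs ++ n ∷ []) * φ d
      ≡⟨ cong (λ t → ∏∣ d (differences ms) * t * φ d) (∏∣-++ (toList bs) (n ∷ [])) ⟩
    ∏∣ d (differences ms) * (∏∣ d (toList bs) * (𝟙 (d ∣? n) * 1)) * φ d
      ≡⟨ cong (λ t → ∏∣ d (differences ms) * (∏∣ d (toList bs) * (t * 1)) * φ d) (𝟙-yes (d ∣? n) d∣n) ⟩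
    ∏∣ d (differences ms) * (∏∣ d (toList bs) * 1) * φ d
      ≡⟨ rearrange (∏∣ d (differences ms)) (∏∣ d (toList bs)) (φ d) ⟩
    T d ms bs
      ∎
    where
    ∏∣-++ : ∀ xs ys → ∏∣ d (xs ++ ys) ≡ ∏∣ d xs * ∏∣ d ys
    ∏∣-++ xs ys = trans (cong product (map-++ _ xs ys)) (product-++ (map _ xs) (map _ ys))
    rearrange : ∀ p q f → p * (q * 1) * f ≡ f * p * q
    rearrange = solve-∀

  count : ∀ d .{{_ : NonZero d}} → d ∣ n → (∑[ ms ∈ Ms ] ∑[ bs ∈ Bs ] T d ms bs) ≡ divisorTerm k r n d
  count d@(suc _) d∣n = begin
    (∑[ ms ∈ Ms ] ∑[ bs ∈ Bs ] T d ms bs)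
      ≡⟨ ∑-cong Ms (λ ms → ∑-*ˡ Bs (φ d * ∏∣ d (differences ms)) (λ bs → ∏∣ d (toList bs))) ⟩
    (∑[ ms ∈ Ms ] φ d * ∏∣ d (differences ms) * (∑[ bs ∈ Bs ] ∏∣ d (toList bs)))
      ≡⟨ ∑-*ʳ Ms _ (λ ms → φ d * ∏∣ d (differences ms)) ⟩
    (∑[ ms ∈ Ms ] φ d * ∏∣ d (differences ms)) * (∑[ bs ∈ Bs ] ∏∣ d (toList bs))
      ≡⟨ cong (_* (∑[ bs ∈ Bs ] ∏∣ d (toList bs))) (∑-*ˡ Ms (φ d) (λ ms → ∏∣ d (differences ms))) ⟩
    φ d * (∑[ ms ∈ Ms ] ∏∣ d (differences ms)) * (∑[ bs ∈ Bs ] ∏∣ d (toList bs))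
      ≡⟨ cong₂ (λ s t → φ d * s * t)
           (∑-tuples-∏-zipWith k (units n) _ _ a _ (λ i → ∑-units-congruent n d d∣n (lookup a i) (a⊥n i)))
           (trans (∑-tuples-∏ r (range1 n) _) (cong (_^ r) (∑-range1-multiples n d d∣n))) ⟩
    φ d * unitsCongruent n d 1 ^ k * (n div d) ^ r
      ∎

-- The right-hand side

∑ℚ : List ℚ → ℚ
∑ℚ = foldr ℚ._+_ 0ℚ

∑ℚ-*ˡ : ∀ p (xs : List ℕ) (f : ℕ → ℚ) → p ℚ.* ∑ℚ (map f xs) ≡ ∑ℚ (map (λ x → p ℚ.* f x) xs)
∑ℚ-*ˡ p []       f = ℚ.*-zeroʳ p
∑ℚ-*ˡ p (x ∷ xs) f = trans (ℚ.*-distribˡ-+ p (f x) _) (cong (p ℚ.* f x ℚ.+_) (∑ℚ-*ˡ p xs f))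

toℚᵘ-/1 : ∀ a → toℚᵘ ((+ a) / 1) ℚᵘ.≃ mkℚᵘ (+ a) 0
toℚᵘ-/1 a = ℚ.toℚᵘ-fromℚᵘ (mkℚᵘ (+ a) 0)

+-homo-/1 : ∀ a b → (+ a) / 1 ℚ.+ (+ b) / 1 ≡ (+ (a + b)) / 1
+-homo-/1 a b = ℚ.toℚᵘ-injective (ℚᵘ.≃-trans (ℚ.toℚᵘ-homo-+ ((+ a) / 1) ((+ b) / 1))
  (ℚᵘ.≃-trans (ℚᵘ.+-cong (toℚᵘ-/1 a) (toℚᵘ-/1 b))
    (ℚᵘ.≃-trans (*≡* cross) (ℚᵘ.≃-sym (toℚᵘ-/1 (a + b))))))
  where
  cross : (+ a ℤ.* + 1 ℤ.+ + b ℤ.* + 1) ℤ.* + 1 ≡ + (a + b) ℤ.* + 1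
  cross = trans (normalise (+ a) (+ b)) (cong (ℤ._* + 1) (sym (ℤ.pos-+ a b)))
    where
    normalise : ∀ A B → (A ℤ.* + 1 ℤ.+ B ℤ.* + 1) ℤ.* + 1 ≡ (A ℤ.+ B) ℤ.* + 1
    normalise = ℤ-solve-∀

∑ℚ-/1 : ∀ (xs : List ℕ) f → ∑ℚ (map (λ x → (+ f x) / 1) xs) ≡ (+ ∑ xs f) / 1
∑ℚ-/1 []       f = refl
∑ℚ-/1 (x ∷ xs) f = trans (cong ((+ f x) / 1 ℚ.+_) (∑ℚ-/1 xs f)) (+-homo-/1 (f x) (∑ xs f))

/1-*-⁄ : ∀ p x y z .{{_ : NonZero y}} → p * x ≡ z * y → (+ p) / 1 ℚ.* (x ⁄ y) ≡ (+ z) / 1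
/1-*-⁄ p x (suc y) z px≡zy = ℚ.toℚᵘ-injective (ℚᵘ.≃-trans (ℚ.toℚᵘ-homo-* ((+ p) / 1) ((+ x) / suc y))
  (ℚᵘ.≃-trans (ℚᵘ.*-cong (toℚᵘ-/1 p) (ℚ.toℚᵘ-fromℚᵘ (mkℚᵘ (+ x) y)))
    (ℚᵘ.≃-trans (*≡* cross) (ℚᵘ.≃-sym (toℚᵘ-/1 z)))))
  where
  cross : + p ℤ.* + x ℤ.* + 1 ≡ + z ℤ.* + (1 * suc y)
  cross = begin
    + p ℤ.* + x ℤ.* + 1     ≡⟨ ℤ.*-identityʳ (+ p ℤ.* + x) ⟩
    + p ℤ.* + x             ≡⟨ ℤ.pos-* p x ⟨
    + (p * x)               ≡⟨ cong +_ (trans px≡zy (cong (z *_) (sym (*-identityˡ (suc y))))) ⟩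
    + (z * (1 * suc y))     ≡⟨ ℤ.pos-* z (1 * suc y) ⟩
    + z ℤ.* + (1 * suc y)   ∎

^-distribʳ-* : ∀ a b m → (a * b) ^ m ≡ a ^ m * b ^ m
^-distribʳ-* a b zero    = refl
^-distribʳ-* a b (suc m) = trans (cong (a * b *_) (^-distribʳ-* a b m)) (interchange a b (a ^ m) (b ^ m))
  where
  interchange : ∀ a b x y → a * b * (x * y) ≡ a * x * (b * y)
  interchange = solve-∀

-- Cross-multiplied form of  (p u)^(k+1) t / p^k = p u^(k+1) t.
^-cancel-cross : ∀ k p u t → (p * u) ^ suc k * t ≡ p * u ^ suc k * t * p ^ k
^-cancel-cross k p u t = begin
  (p * u) ^ suc k * t                  ≡⟨ cong (λ x → p * u * x * t) (^-distribʳ-* p u k) ⟩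
  p * u * (p ^ k * u ^ k) * t          ≡⟨ rearrange p u (p ^ k) (u ^ k) t ⟩
  p * (u * u ^ k) * t * p ^ k          ∎
  where
  rearrange : ∀ p u pᵏ uᵏ t → p * u * (pᵏ * uᵏ) * t ≡ p * (u * uᵏ) * t * pᵏ
  rearrange = solve-∀

module _ n .{{_ : NonZero n}} d .{{_ : NonZero d}} (d∣n : d ∣ n) where

  private
    q : ℕ
    q = quotient d∣n
    n≡q*d : n ≡ q * d
    n≡q*d = m∣n⇒n≡quotient*m d∣n
    n/d≡q : n ℕ./ d ≡ q
    n/d≡q = trans (cong (ℕ._/ d) n≡q*d) (m*n/n≡m q d)

  n/d-nonZero : NonZero (n ℕ./ d)
  n/d-nonZero = ≢-nonZero λ n/d≡0 → ≢-nonZero⁻¹ n (trans n≡q*d (cong (_* d) (trans (sym n/d≡q) n/d≡0)))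

  div-n/d : n div (n ℕ./ d) ≡ d
  div-n/d = trans (cong (n div_) n/d≡q) (div-q q refl)
    where
    div-q : ∀ m → m ≡ q → n div m ≡ d
    div-q zero      0≡q = contradiction (trans n≡q*d (cong (_* d) (sym 0≡q))) (≢-nonZero⁻¹ n)
    div-q (suc m-1) m≡q = begin
      n ℕ./ suc m-1           ≡⟨ cong (ℕ._/ suc m-1) (trans n≡q*d (cong (_* d) (sym m≡q))) ⟩
      suc m-1 * d ℕ./ suc m-1 ≡⟨ cong (ℕ._/ suc m-1) (*-comm (suc m-1) d) ⟩
      d * suc m-1 ℕ./ suc m-1 ≡⟨ m*n/n≡m d (suc m-1) ⟩
      d                       ∎

rhs-term : ∀ k-1 r n .{{_ : NonZero n}} d .{{_ : NonZero d}} → d ∣ n →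
  (+ (φ n ^ suc k-1)) / 1 ℚ.* ((d ^ r) ⁄ (φ (n div d) ^ k-1)) ≡ (+ divisorTerm (suc k-1) r n (n div d)) / 1
rhs-term k-1 r n d@(suc _) d∣n = /1-*-⁄ (φ n ^ k) (d ^ r) (φ e ^ k-1) (divisorTerm k r n e)
  {{m^n≢0 (φ e) k-1 {{φ-nonZero e}}}} (begin
    φ n ^ k * d ^ r                   ≡⟨ cong (λ x → x ^ k * d ^ r) (φ-factor n e (m/n∣m d∣n)) ⟩
    (φ e * ψ) ^ k * d ^ r             ≡⟨ ^-cancel-cross k-1 (φ e) ψ (d ^ r) ⟩
    φ e * ψ ^ k * d ^ r * φ e ^ k-1   ≡⟨ cong (λ x → φ e * ψ ^ k * x ^ r * φ e ^ k-1) (div-n/d n d d∣n) ⟨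
    divisorTerm k r n e * φ e ^ k-1   ∎)
  where
  k e ψ : ℕ
  k = suc k-1
  e = n ℕ./ d
  ψ = unitsCongruent n e 1
  instance
    e-nonZero : NonZero e
    e-nonZero = n/d-nonZero n d d∣n

corollary3p4 : (k r n : ℕ) → .{{_ : NonZero k}} → .{{_ : NonZero r}} → .{{_ : NonZero n}} →
    (a : Vec ℤ k) → (∀ (i : Fin k) → Coprime ∣ lookup a i ∣ n) →
    (+ lhs k r n a) / 1 ≡ rhs k r n
corollary3p4 k@(suc k-1) r n a a⊥n = begin
  (+ lhs k r n a) / 1
    ≡⟨ cong (λ t → (+ t) / 1) (trans (lhs≡∑-divisors k r n a a⊥n) (∑-divisors-complement n (divisorTerm k r n))) ⟩
  (+ (∑[ d ∈ divisors n ] divisorTerm k r n (n div d))) / 1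
    ≡⟨ ∑ℚ-/1 (divisors n) (λ d → divisorTerm k r n (n div d)) ⟨
  ∑ℚ (map (λ d → (+ divisorTerm k r n (n div d)) / 1) (divisors n))
    ≡⟨ cong ∑ℚ (map-cong-local (All-divisors n (rhs-term k-1 r n))) ⟨
  ∑ℚ (map (λ d → (+ (φ n ^ k)) / 1 ℚ.* ((d ^ r) ⁄ (φ (n div d) ^ k-1))) (divisors n))
    ≡⟨ ∑ℚ-*ˡ ((+ (φ n ^ k)) / 1) (divisors n) (λ d → (d ^ r) ⁄ (φ (n div d) ^ k-1)) ⟨
  rhs k r n
    ∎
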